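{- Let $\mathcal{P}$ be a finite set of quasi-density properties and $\varphi$ a modal formula. If $\overline{\varphi}$ is $\mathcal{P}$-valid, then $\mathsf{contr}\in\mathcal{C}$ for every $\mathcal{C}\in\mathrm{Ch}(\mathcal{D}_\varphi,\mathcal{R}_\varphi\cup\mathcal{P})$.
   Context: Modal formulae are in negation normal form ($p,\neg p,\lor,\land,\Diamond,\Box$); $\overline\psi$ is the dual negation ($\overline p=\neg p$, $\overline{\neg p}=p$, swap $\lor/\land$ and $\Diamond/\Box$ recursively). A quasi-density property (QDP) is $\forall x,y\,(R^k(x,y)\to R^n(x,y))$ with $0<k<n$ ($R^\ell$ = existence of an $R$-path of length $\ell$); a $\mathcal P$-model is a Kripke model whose accessibility relation satisfies all QDPs in $\mathcal P$; $\psi$ is $\mathcal P$-valid if true at all worlds of all $\mathcal P$-models. Terms are words over disjoint countable sets of constants and variables; an instance is a (possibly infinite) set of atoms over terms. The signature has unary $P_\psi$ (for each subformula $\psi$ of $\varphi$), binary $R,E$ and nullary $\mathsf{contr}$. $\mathcal{D}_\varphi=\{P_\varphi(a)\}$ for a fixed constant $a$. Each QDP is the rule $R(x,y_1)\land\cdots\land R(y_{k-1},y)\to\exists z_1..z_{n-1}\,R(x,z_1)\land\cdots\land R(z_{n-1},y)$. $\mathcal R_\varphi$ consists of, for subformulae $\psi,\chi$ of $\varphi$: $P_{\psi\land\chi}(x)\to P_\psi(x)\land P_\chi(x)$; $P_{\psi\lor\chi}(x)\to P_\psi(x)\lor P_\chi(x)$; $P_{\Box\psi}(x)\land R(x,y)\to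 P_\psi(y)$; $P_{\Diamond\psi}(x)\to\exists y(R(x,y)\land E(x,y)\land P_\psi(y))$; $P_\psi(x)\land P_{\overline\psi}(x)\to\mathsf{contr}$. Disjunctive chase: a homomorphism maps terms to terms preserving atoms and fixing constants. A trigger in an instance $I$ is a pair $(\rho,h)$ with $h$ a homomorphism from the body of rule $\rho$ into $I$; it is active if there is no disjunct $\gamma$ of the head such that $h$ extends to a homomorphism of $\mathrm{body}(\rho)\land\gamma$ into $I$. Applying an active trigger yields the set of instances $I\cup\alpha(h(\vec y),\vec t)$, one for each disjunct $\exists\vec z\,\alpha(\vec y,\vec z)$ of the head, with $\vec t$ fresh terms. A fair derivation sequence of $I$ and a rule set $\mathcal R$ is a sequence $(I_i)$ with $I_0=I$, each $I_{i+1}$ in the application of some trigger in $I_i$, such that no trigger stays active indefinitely. $\mathrm{Ch}(I,\mathcal R)$ is the set of unions $\bigcup_i I_i$ over all fair derivation sequences. -}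

module Defs where

open import Data.Nat using (ℕ; zero; suc; _+_; _∸_; _<_; _≤_)
open import Data.Nat.Properties using (_≟_)
open import Data.List using (List; []; _∷_; _++_; map; concatMap; upTo)
open import Data.List.Membership.Propositional using (_∈_; _∉_)
open import Data.List.Relation.Unary.All using (All)
open import Data.Product using (Σ; _×_; _,_; ∃)
open import Data.Sum using (_⊎_; inj₁; inj₂)
open import Data.Empty using (⊥)
open import Relation.Nullary using (¬_)
open import Relation.Binary.PropositionalEquality using (_≡_)

-- Modal formulae in negation normal form (propositional letters are ℕ)

data Form : Set where
  var  : ℕ → Form
  nvar : ℕ → Form
  _∨'_ : Form → Form → Form
  _∧'_ : Form → Form → Form
  ◇    : Form → Form
  □    : Form → Form

dual : Form → Form
dual (var p)   = nvar p
dual (nvar p)  = var p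
dual (ψ ∨' χ)  = dual ψ ∧' dual χ
dual (ψ ∧' χ)  = dual ψ ∨' dual χ
dual (◇ ψ)     = □ (dual ψ)
dual (□ ψ)     = ◇ (dual ψ)

data Sub (ψ : Form) : Form → Set where
  here  : Sub ψ ψ
  ∨l : ∀ {a b} → Sub ψ a → Sub ψ (a ∨' b)
  ∨r : ∀ {a b} → Sub ψ b → Sub ψ (a ∨' b)
  ∧l : ∀ {a b} → Sub ψ a → Sub ψ (a ∧' b)
  ∧r : ∀ {a b} → Sub ψ b → Sub ψ (a ∧' b)
  ◇s : ∀ {a} → Sub ψ a → Sub ψ (◇ a)
  □s : ∀ {a} → Sub ψ a → Sub ψ (□ a)

record Model : Set₁ where
  field
    W   : Set
    Rel : W → W → Set
    Val : ℕ → W → Set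

open Model public

data Path {W : Set} (R : W → W → Set) : ℕ → W → W → Set where
  nil  : ∀ {w} → Path R zero w w
  cons : ∀ {n w u v} → R w u → Path R n u v → Path R (suc n) w v

_⊨_at_ : (M : Model) → Form → W M → Set
M ⊨ var p  at w = Val M p w
M ⊨ nvar p at w = ¬ Val M p w
M ⊨ ψ ∨' χ at w = (M ⊨ ψ at w) ⊎ (M ⊨ χ at w)
M ⊨ ψ ∧' χ at w = (M ⊨ ψ at w) × (M ⊨ χ at w)
M ⊨ ◇ ψ at w = Σ (W M) λ v → Rel M w v × (M ⊨ ψ at v)
M ⊨ □ ψ at w = (v : W M) → Rel M w v → M ⊨ ψ at v

record QDP : Set where
  field
    k n : ℕ
    0<k : 0 < k
    k<n : k < n

open QDP public

SatQDP : Model → QDP → Set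
SatQDP M q = ∀ x y → Path (Rel M) (k q) x y → Path (Rel M) (n q) x y

IsPModel : List QDP → Model → Set
IsPModel 𝒫 M = All (SatQDP M) 𝒫

Valid : List QDP → Form → Set₁
Valid 𝒫 ψ = (M : Model) → IsPModel 𝒫 M → (w : W M) → M ⊨ ψ at w

data Atom (T : Set) : Set where
  P    : Form → T → Atom T
  R    : T → T → Atom T
  E    : T → T → Atom T
  contr : Atom T

mapAtom : {S T : Set} → (S → T) → Atom S → Atom T
mapAtom f (P ψ t) = P ψ (f t)
mapAtom f (R s t) = R (f s) (f t)
mapAtom f (E s t) = E (f s) (f t)
mapAtom f contr   = contr

termsOf : {T : Set} → Atom T → List T
termsOf (P ψ t) = t ∷ []
termsOf (R s t) = s ∷ t ∷ []
termsOf (E s t) = s ∷ t ∷ []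
termsOf contr   = []

-- terms: words over constants (inj₁) and variables (inj₂)
Term : Set
Term = List (ℕ ⊎ ℕ)

aConst : Term
aConst = inj₁ 0 ∷ []

Instance : Set₁
Instance = Atom Term → Set

_≐_ : Instance → Instance → Set
I ≐ J = ∀ α → (I α → J α) × (J α → I α)

Occurs : Term → Instance → Set
Occurs t I = Σ (Atom Term) λ α → I α × t ∈ termsOf α

record Rule : Set where
  constructor rule
  field
    body : List (Atom ℕ)
    head : List (List (Atom ℕ))   -- disjuncts; head-only variables are existential

open Rule public

RuleSet : Set₁
RuleSet = Rule → Set

varsOf : List (Atom ℕ) → List ℕ
varsOf = concatMap termsOf

IsHom : List (Atom ℕ) → (ℕ → Term) → Instance → Set
IsHom as h I = All (λ α → I (mapAtom h α)) as

Extends : List (Atom ℕ) → (ℕ → Term) → (ℕ → Term) → Set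
Extends bd g h = ∀ x → x ∈ varsOf bd → g x ≡ h x

-- trigger (ρ , h) active in I (assuming IsHom (body ρ) h I)
Active : Rule → (ℕ → Term) → Instance → Set
Active ρ h I =
  ¬ (Σ (List (Atom ℕ)) λ γ → γ ∈ head ρ ×
      Σ (ℕ → Term) λ g → Extends (body ρ) g h × IsHom (body ρ ++ γ) g I)

NoActiveTrigger : RuleSet → Instance → Set
NoActiveTrigger ℛ I =
  ∀ ρ h → ℛ ρ → IsHom (body ρ) h I → ¬ Active ρ h I

ApplicationStep : RuleSet → Instance → Instance → Set
ApplicationStep ℛ I J =
  Σ Rule λ ρ → ℛ ρ × Σ (ℕ → Term) λ h → IsHom (body ρ) h I × Active ρ h I ×
  Σ (List (Atom ℕ)) λ γ → γ ∈ head ρ ×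
  Σ (ℕ → Term) λ g → Extends (body ρ) g h ×
    (∀ x → x ∈ varsOf γ → x ∉ varsOf (body ρ) → ¬ Occurs (g x) I) ×
    (∀ x y → x ∈ varsOf γ → x ∉ varsOf (body ρ) →
             y ∈ varsOf γ → y ∉ varsOf (body ρ) → g x ≡ g y → x ≡ y) ×
    (J ≐ (λ α → I α ⊎ Σ (Atom ℕ) λ β → β ∈ γ × mapAtom g β ≡ α))

-- fair derivation sequences.  A finite sequence I₀ … I_m (whose last
-- element has no active trigger) is represented by padding it with
-- I_m forever.
record FairDerivation (I : Instance) (ℛ : RuleSet) : Set₁ where
  field
    seq   : ℕ → Instance
    start : seq 0 ≐ I
    step  : ∀ i → ApplicationStep ℛ (seq i) (seq (suc i))
                  ⊎ (NoActiveTrigger ℛ (seq i) × (seq (suc i) ≐ seq i))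
    fair  : ∀ i ρ h → ℛ ρ → IsHom (body ρ) h (seq i) → Active ρ h (seq i) →
            Σ ℕ λ j → i ≤ j × ¬ Active ρ h (seq j)

open FairDerivation public

InChase : Instance → RuleSet → Instance → Set₁
InChase I ℛ C = Σ (FairDerivation I ℛ) λ d → C ≐ (λ α → Σ ℕ λ i → seq d i α)

-- variables: x = 0, y = 1
data ℛφ (φ : Form) : RuleSet where
  r∧ : ∀ ψ χ → Sub (ψ ∧' χ) φ →
       ℛφ φ (rule (P (ψ ∧' χ) 0 ∷ []) ((P ψ 0 ∷ P χ 0 ∷ []) ∷ []))
  r∨ : ∀ ψ χ → Sub (ψ ∨' χ) φ →
       ℛφ φ (rule (P (ψ ∨' χ) 0 ∷ []) ((P ψ 0 ∷ []) ∷ (P χ 0 ∷ []) ∷ []))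
  r□ : ∀ ψ → Sub (□ ψ) φ →
       ℛφ φ (rule (P (□ ψ) 0 ∷ R 0 1 ∷ []) ((P ψ 1 ∷ []) ∷ []))
  r◇ : ∀ ψ → Sub (◇ ψ) φ →
       ℛφ φ (rule (P (◇ ψ) 0 ∷ []) ((R 0 1 ∷ E 0 1 ∷ P ψ 1 ∷ []) ∷ []))
  rcontr : ∀ ψ → Sub ψ φ →
       ℛφ φ (rule (P ψ 0 ∷ P (dual ψ) 0 ∷ []) ((contr ∷ []) ∷ []))

pathAtoms : ℕ → List ℕ → ℕ → List (Atom ℕ)
pathAtoms s []       e = R s e ∷ []
pathAtoms s (m ∷ ms) e = R s m ∷ pathAtoms m ms e

-- QDP rule: x = 0, y = 1, y₁..y_{k-1} = 2..k, z₁..z_{n-1} = k+1..k+n-1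
qdpRule : QDP → Rule
qdpRule q =
  rule (pathAtoms 0 (map (λ i → 2 + i) (upTo (k q ∸ 1))) 1)
       (pathAtoms 0 (map (λ i → suc (k q) + i) (upTo (n q ∸ 1))) 1 ∷ [])

_∪ℛ𝒫_ : RuleSet → List QDP → RuleSet
(ℛ ∪ℛ𝒫 𝒫) ρ = ℛ ρ ⊎ Σ QDP λ q → q ∈ 𝒫 × ρ ≡ qdpRule q

𝒟 : Form → Instance
𝒟 φ α = α ≡ P φ aConst

module Submission where

open import Defs
open import Axiom.ExcludedMiddle using (ExcludedMiddle)
open import Axiom.DoubleNegationElimination using (DoubleNegationElimination; em⇒dne)
open import Level using (0ℓ)
open import Data.List using (List; []; _∷_; _++_; map; length; upTo; applyUpTo)
open import Data.List.Properties using (length-map; length-upTo; map-upTo)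
open import Data.List.Membership.Propositional using (_∈_)
open import Data.List.Membership.Propositional.Properties using (∈-++⁺ʳ)
open import Data.List.Relation.Unary.Any using (here; there)
open import Data.List.Relation.Unary.All as All using (All; []; _∷_)
open import Data.List.Relation.Unary.All.Properties using (++⁻ʳ)
open import Data.Nat using (ℕ; zero; suc; _+_; _≤_; _≤′_; ≤′-refl; ≤′-step; _⊔_)
open import Data.Nat.Properties using (≤⇒≤′; m≤m⊔n; m≤n⊔m)
open import Data.Product using (Σ; _×_; _,_; proj₁; proj₂)
open import Data.Sum using (_⊎_; inj₁; inj₂)
open import Data.Unit using (⊤; tt)
open import Data.Empty using (⊥-elim)
open import Function using (const)
open import Relation.Nullary using (¬_; Dec; yes; no)
open import Relation.Binary.PropositionalEquality using (_≡_; refl; sym; trans; cong; cong₂; subst; subst₂)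

-- The result C of the chase is read as a Kripke model whose worlds are terms,
-- whose accessibility relation is given by the R-atoms and whose letters by the
-- P_p-atoms.  C satisfies every rule, so this is a 𝒫-model, and a truth lemma
-- shows that P_ψ(t) ∈ C together with truth of ψ̄ at t forces contr ∈ C; taking
-- ψ = φ and t = a, validity of φ̄ finishes the proof.
-- Constructively, fairness only makes each trigger doubly-negatively satisfied.
-- The missing excluded middle comes from the hypothesis itself: φ̄ holds in the
-- one-world model in which every letter means A, and that decides A.

Sub-trans : ∀ {ψ χ φ} → Sub ψ χ → Sub χ φ → Sub ψ φ
Sub-trans s here   = s
Sub-trans s (∨l t) = ∨l (Sub-trans s t)
Sub-trans s (∨r t) = ∨r (Sub-trans s t)
Sub-trans s (∧l t) = ∧l (Sub-trans s t)
Sub-trans s (∧r t) = ∧r (Sub-trans s t)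
Sub-trans s (◇s t) = ◇s (Sub-trans s t)
Sub-trans s (□s t) = □s (Sub-trans s t)

-- The node reached after i steps along p; the end node for i ≥ n.
vertex : ∀ {W : Set} {Rl : W → W → Set} {n u v} → Path Rl n u v → ℕ → W
vertex {u = u} _          zero    = u
vertex {u = u} nil        (suc _) = u
vertex         (cons _ p) (suc i) = vertex p i

RAtoms : Instance → Term → Term → Set
RAtoms I s t = I (R s t)

pathAtoms-start∈ : ∀ s ms e → s ∈ varsOf (pathAtoms s ms e)
pathAtoms-start∈ s []      e = here refl
pathAtoms-start∈ s (_ ∷ _) e = here refl

pathAtoms-end∈ : ∀ s ms e → e ∈ varsOf (pathAtoms s ms e)
pathAtoms-end∈ s []       e = there (here refl)
pathAtoms-end∈ s (m ∷ ms) e = ∈-++⁺ʳ (s ∷ m ∷ []) (pathAtoms-end∈ m ms e)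

path⇒pathAtoms-hom : ∀ {I} h {s e} (g : ℕ → ℕ) {m u v} (p : Path (RAtoms I) (suc m) u v) →
  h s ≡ u → h e ≡ v → (∀ i → h (g i) ≡ vertex p (suc i)) →
  IsHom (pathAtoms s (applyUpTo g m) e) h I
path⇒pathAtoms-hom {I} h g {zero} (cons r nil) hs he _ =
  subst I (sym (cong₂ R hs he)) r ∷ []
path⇒pathAtoms-hom {I} h g {suc m} (cons r p) hs he hg =
  subst I (sym (cong₂ R hs (hg 0))) r ∷
  path⇒pathAtoms-hom {I} h (λ i → g (suc i)) p (hg 0) he (λ i → hg (suc i))

pathAtoms-hom⇒path : ∀ {I g} s ms e → IsHom (pathAtoms s ms e) g I →
  Path (RAtoms I) (suc (length ms)) (g s) (g e)
pathAtoms-hom⇒path         s []       e (r ∷ []) = cons r nil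
pathAtoms-hom⇒path {I} {g} s (m ∷ ms) e (r ∷ rs) = cons r (pathAtoms-hom⇒path {I} {g} m ms e rs)

constantModel : Set → Model
constantModel A = record { W = ⊤ ; Rel = λ _ _ → ⊤ ; Val = λ _ _ → A }

constantModel-isPModel : ∀ A 𝒫 → IsPModel 𝒫 (constantModel A)
constantModel-isPModel A 𝒫 = All.tabulate λ {q} _ _ _ _ → loop (n q)
  where
  loop : ∀ n → Path (λ (_ _ : ⊤) → ⊤) n tt tt
  loop zero    = nil
  loop (suc n) = cons tt (loop n)

constantModel-decides : ∀ A ψ → constantModel A ⊨ ψ at tt → Dec A
constantModel-decides A (var p)  a          = yes a
constantModel-decides A (nvar p) ¬a         = no ¬a
constantModel-decides A (ψ ∨' χ) (inj₁ x)   = constantModel-decides A ψ x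
constantModel-decides A (ψ ∨' χ) (inj₂ x)   = constantModel-decides A χ x
constantModel-decides A (ψ ∧' χ) (x , _)    = constantModel-decides A ψ x
constantModel-decides A (◇ ψ)    (_ , _ , x) = constantModel-decides A ψ x
constantModel-decides A (□ ψ)    f          = constantModel-decides A ψ (f tt tt)

valid⇒em : ∀ 𝒫 ψ → Valid 𝒫 ψ → ExcludedMiddle 0ℓ
valid⇒em 𝒫 ψ valid {A} =
  constantModel-decides A ψ (valid (constantModel A) (constantModel-isPModel A 𝒫) tt)

Satisfied : Rule → (ℕ → Term) → Instance → Set
Satisfied ρ h I = Σ (List (Atom ℕ)) λ γ → γ ∈ head ρ ×
  Σ (ℕ → Term) λ g → Extends (body ρ) g h × IsHom (body ρ ++ γ) g I

Models : RuleSet → Instance → Set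
Models ℛ I = ∀ ρ h → ℛ ρ → IsHom (body ρ) h I → Satisfied ρ h I

_⊆ᴵ_ : Instance → Instance → Set
I ⊆ᴵ J = ∀ {α} → I α → J α

IsHom-mono : ∀ {I J} as h → I ⊆ᴵ J → IsHom as h I → IsHom as h J
IsHom-mono as h I⊆J = All.map (λ {α} → I⊆J {mapAtom h α})

Satisfied-mono : ∀ {I J} ρ h → I ⊆ᴵ J → Satisfied ρ h I → Satisfied ρ h J
Satisfied-mono {I} {J} ρ h I⊆J (γ , γ∈ , g , ext , hom) =
  γ , γ∈ , g , ext , IsHom-mono {I} {J} (body ρ ++ γ) g I⊆J hom

module FairDerivationProperties {I ℛ} (d : FairDerivation I ℛ) where

  Result : Instance
  Result α = Σ ℕ λ i → seq d i α

  seq-⊆-suc : ∀ i → seq d i ⊆ᴵ seq d (suc i)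
  seq-⊆-suc i {α} x with step d i
  ... | inj₁ (_ , _ , _ , _ , _ , _ , _ , _ , _ , _ , _ , eq) = proj₂ (eq α) (inj₁ x)
  ... | inj₂ (_ , eq) = proj₂ (eq α) x

  seq-mono′ : ∀ {i j} → i ≤′ j → seq d i ⊆ᴵ seq d j
  seq-mono′ ≤′-refl       x = x
  seq-mono′ (≤′-step i≤j) x = seq-⊆-suc _ (seq-mono′ i≤j x)

  seq-mono : ∀ {i j} → i ≤ j → seq d i ⊆ᴵ seq d j
  seq-mono i≤j = seq-mono′ (≤⇒≤′ i≤j)

  seq-⊆-Result : ∀ i → seq d i ⊆ᴵ Result
  seq-⊆-Result i x = i , x

  IsHom-Result⇒stage : ∀ as h → IsHom as h Result → Σ ℕ λ m → IsHom as h (seq d m)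
  IsHom-Result⇒stage []       h []                = 0 , []
  IsHom-Result⇒stage (α ∷ as) h ((i , x) ∷ homs) with IsHom-Result⇒stage as h homs
  ... | m , hom = i ⊔ m , seq-mono (m≤m⊔n i m) x ∷ IsHom-mono {seq d m} as h (seq-mono (m≤n⊔m i m)) hom

  -- An unsatisfied trigger stays active forever, contradicting fairness.
  ¬¬satisfied-at-some-stage : ∀ {ρ h m} → ℛ ρ → IsHom (body ρ) h (seq d m) →
    ¬ ¬ (Σ ℕ λ j → Satisfied ρ h (seq d j))
  ¬¬satisfied-at-some-stage {ρ} {h} {m} ρ∈ℛ hom never
    with fair d m ρ h ρ∈ℛ hom (λ sat → never (m , sat))
  ... | j , _ , ¬active = ¬active (λ sat → never (j , sat))

  Result-models : DoubleNegationElimination 0ℓ → Models ℛ Result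
  Result-models dne ρ h ρ∈ℛ hom with IsHom-Result⇒stage (body ρ) h hom
  ... | m , homₘ with dne (¬¬satisfied-at-some-stage ρ∈ℛ homₘ)
  ... | j , sat = Satisfied-mono {seq d j} ρ h (seq-⊆-Result j) sat

InChase⇒Models : ∀ {I ℛ C} → DoubleNegationElimination 0ℓ → InChase I ℛ C → Models ℛ C
InChase⇒Models {C = C} dne (d , C≐) ρ h ρ∈ℛ hom =
  Satisfied-mono {J = C} ρ h (λ {α} → proj₂ (C≐ α))
    (Result-models dne ρ h ρ∈ℛ (IsHom-mono {C} (body ρ) h (λ {α} → proj₁ (C≐ α)) hom))
  where open FairDerivationProperties d

InChase-initial : ∀ {I ℛ C} → InChase I ℛ C → I ⊆ᴵ C
InChase-initial (d , C≐) {α} x = proj₂ (C≐ α) (0 , proj₂ (start d α) x)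

canonicalModel : Instance → Model
canonicalModel C = record { W = Term ; Rel = RAtoms C ; Val = λ p t → C (P (var p) t) }

module CanonicalModel {φ 𝒫 C} (models : Models (ℛφ φ ∪ℛ𝒫 𝒫) C) where

  ∧-closed : ∀ {ψ χ t} → Sub (ψ ∧' χ) φ → C (P (ψ ∧' χ) t) → C (P ψ t) × C (P χ t)
  ∧-closed {ψ} {χ} {t} s x with models _ (const t) (inj₁ (r∧ ψ χ s)) (x ∷ [])
  ... | _ , here refl , g , ext , (_ ∷ a ∷ b ∷ []) =
    subst (λ u → C (P ψ u)) (ext 0 (here refl)) a , subst (λ u → C (P χ u)) (ext 0 (here refl)) b

  ∨-closed : ∀ {ψ χ t} → Sub (ψ ∨' χ) φ → C (P (ψ ∨' χ) t) → C (P ψ t) ⊎ C (P χ t)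
  ∨-closed {ψ} {χ} {t} s x with models _ (const t) (inj₁ (r∨ ψ χ s)) (x ∷ [])
  ... | _ , here refl , g , ext , (_ ∷ a ∷ []) = inj₁ (subst (λ u → C (P ψ u)) (ext 0 (here refl)) a)
  ... | _ , there (here refl) , g , ext , (_ ∷ b ∷ []) = inj₂ (subst (λ u → C (P χ u)) (ext 0 (here refl)) b)

  □-closed : ∀ {ψ t v} → Sub (□ ψ) φ → C (P (□ ψ) t) → C (R t v) → C (P ψ v)
  □-closed {ψ} {t} {v} s x r with models _ edge (inj₁ (r□ ψ s)) (x ∷ r ∷ [])
    where
    edge : ℕ → Term
    edge zero    = t
    edge (suc _) = v
  ... | _ , here refl , g , ext , (_ ∷ _ ∷ a ∷ []) =
    subst (λ u → C (P ψ u)) (ext 1 (there (there (here refl)))) a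

  ◇-closed : ∀ {ψ t} → Sub (◇ ψ) φ → C (P (◇ ψ) t) → Σ Term λ v → C (R t v) × C (P ψ v)
  ◇-closed {ψ} {t} s x with models _ (const t) (inj₁ (r◇ ψ s)) (x ∷ [])
  ... | _ , here refl , g , ext , (_ ∷ r ∷ _ ∷ a ∷ []) =
    g 1 , subst (λ u → C (R u (g 1))) (ext 0 (here refl)) r , a

  clash⇒contr : ∀ {ψ t} → Sub ψ φ → C (P ψ t) → C (P (dual ψ) t) → C contr
  clash⇒contr {ψ} {t} s x y with models _ (const t) (inj₁ (rcontr ψ s)) (x ∷ y ∷ [])
  ... | _ , here refl , _ , _ , (_ ∷ _ ∷ c ∷ []) = c

  -- The body variables 0, 1, 2, …, k of the QDP rule go to x, y and the inner nodes of p.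
  pathAssignment : ∀ {n x y} → Path (RAtoms C) n x y → ℕ → Term
  pathAssignment {x = x} p zero          = x
  pathAssignment {y = y} p (suc zero)    = y
  pathAssignment         p (suc (suc i)) = vertex p (suc i)

  canonicalModel-SatQDP : ∀ {q} → q ∈ 𝒫 → SatQDP (canonicalModel C) q
  canonicalModel-SatQDP {q@record { k = suc k′ ; n = suc n′ }} q∈𝒫 x y p
    with models (qdpRule q) (pathAssignment p) (inj₂ (q , q∈𝒫 , refl)) bodyHom
    where
    bodyHom : IsHom (body (qdpRule q)) (pathAssignment p) C
    bodyHom = subst (λ ms → IsHom (pathAtoms 0 ms 1) (pathAssignment p) C)
                    (sym (map-upTo (2 +_) k′))
                    (path⇒pathAtoms-hom {C} (pathAssignment p) (2 +_) p refl refl λ _ → refl)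
  ... | _ , here refl , g , ext , hom =
    subst (λ ℓ → Path (RAtoms C) ℓ x y) (cong suc length-inner)
      (subst₂ (Path (RAtoms C) _) (ext 0 (pathAtoms-start∈ 0 body-inner 1))
                                  (ext 1 (pathAtoms-end∈ 0 body-inner 1))
        (pathAtoms-hom⇒path {C} {g} 0 head-inner 1 (++⁻ʳ (pathAtoms 0 body-inner 1) hom)))
    where
    body-inner = map (2 +_) (upTo k′)
    head-inner = map (suc (suc k′) +_) (upTo n′)
    length-inner : length head-inner ≡ n′
    length-inner = trans (length-map _ (upTo n′)) (length-upTo n′)

  canonicalModel-isPModel : IsPModel 𝒫 (canonicalModel C)
  canonicalModel-isPModel = All.tabulate canonicalModel-SatQDP

  truth-lemma : ∀ {ψ} → Sub ψ φ → ∀ t → C (P ψ t) → canonicalModel C ⊨ dual ψ at t → C contr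
  truth-lemma {var p}  s t x ¬x = ⊥-elim (¬x x)
  truth-lemma {nvar p} s t x y  = clash⇒contr s x y
  truth-lemma {ψ ∧' χ} s t x (inj₁ y) = truth-lemma (Sub-trans (∧l here) s) t (proj₁ (∧-closed s x)) y
  truth-lemma {ψ ∧' χ} s t x (inj₂ y) = truth-lemma (Sub-trans (∧r here) s) t (proj₂ (∧-closed s x)) y
  truth-lemma {ψ ∨' χ} s t x (y , z) with ∨-closed s x
  ... | inj₁ a = truth-lemma (Sub-trans (∨l here) s) t a y
  ... | inj₂ b = truth-lemma (Sub-trans (∨r here) s) t b z
  truth-lemma {◇ ψ} s t x y with ◇-closed s x
  ... | v , r , a = truth-lemma (Sub-trans (◇s here) s) v a (y v r)
  truth-lemma {□ ψ} s t x (v , r , y) = truth-lemma (Sub-trans (□s here) s) v (□-closed s x r) y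

theorem3p5 : (𝒫 : List QDP) (φ : Form) → Valid 𝒫 (dual φ) →
    (C : Instance) → InChase (𝒟 φ) (ℛφ φ ∪ℛ𝒫 𝒫) C → C contr
theorem3p5 𝒫 φ valid C C∈Ch =
  truth-lemma here aConst (InChase-initial C∈Ch refl)
    (valid (canonicalModel C) canonicalModel-isPModel aConst)
  where
  dne : DoubleNegationElimination 0ℓ
  dne = em⇒dne (valid⇒em 𝒫 (dual φ) valid)
  open CanonicalModel {φ} {𝒫} {C} (InChase⇒Models dne C∈Ch)
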